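{- Let $\Gamma$ be a pure graph which is a tree, and let $v_0$ be a vertex of $\Gamma$. Let $D$ be the divisor on $\Gamma$ with $D(v_0)=-1$ and $D(v)=0$ for all $v\ne v_0$. Then $(\emptyset,D)$ is the unique element of $\mathbf{QD}_{v_0}(\Gamma)$.
   Context: Graphs are finite, loops and multiple edges allowed; pure means all weights are 0, genus $g=b_1(\Gamma)$; $\mathrm{val}(v)$ counts loops twice. For $\mathcal E\subset E(\Gamma)$, $\Gamma^{\mathcal E}$ is obtained by inserting one vertex $v_e$ in each $e\in\mathcal E$. A pseudo-divisor is $(\mathcal E,D)$ with $D\colon V(\Gamma^{\mathcal E})\to\mathbb Z$, $D(v_e)=1$ for $e\in\mathcal E$. With $\mu(v)=-1+\mathrm{val}(v)/2$ on $V(\Gamma)$ and $0$ on exceptional vertices, $(\mathcal E,D)$ of degree $g-1$ is $v_0$-quasistable if $D(V)-\mu(V)+\delta_V/2\ge0$ for all nonempty $V\subset V(\Gamma^{\mathcal E})$, strictly when $v_0\notin V$ ($\delta_V$ = number of edges of $\Gamma^{\mathcal E}$ between $V$ and its complement). $\mathbf{QD}_{v_0}(\Gamma)$ is the set of $v_0$-quasistable pseudo-divisors. -}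

module Defs where

open import Data.Nat using (ℕ; zero; suc)
open import Data.Integer using (ℤ; +_; _+_; _-_; _*_; _≤_; _<_; 0ℤ; 1ℤ)
open import Data.Fin using (Fin; zero; suc; _≟_)
open import Data.Bool using (Bool; true; false; if_then_else_; _xor_)
open import Data.Product using (_×_; _,_; proj₁; proj₂; Σ; ∃)
open import Data.Sum using (_⊎_)
open import Relation.Nullary using (¬_)
open import Relation.Nullary.Decidable using (⌊_⌋)
open import Relation.Binary.PropositionalEquality using (_≡_)

-- Pure graph: all weights are 0, so no weight function is recorded.
record Graph : Set where
  field
    n    : ℕ
    m    : ℕ
    ends : Fin m → Fin n × Fin n
open Graph public

Σℤ : {k : ℕ} → (Fin k → ℤ) → ℤ
Σℤ {zero}  f = 0ℤ
Σℤ {suc k} f = f zero + Σℤ (λ i → f (suc i))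

[_] : Bool → ℤ
[ true ]  = 1ℤ
[ false ] = 0ℤ

data Reach (Γ : Graph) : Fin (n Γ) → Fin (n Γ) → Set where
  here  : ∀ {u} → Reach Γ u u
  stepF : ∀ {u w} (e : Fin (m Γ)) → proj₁ (ends Γ e) ≡ u →
          Reach Γ (proj₂ (ends Γ e)) w → Reach Γ u w
  stepB : ∀ {u w} (e : Fin (m Γ)) → proj₂ (ends Γ e) ≡ u →
          Reach Γ (proj₁ (ends Γ e)) w → Reach Γ u w

Connected : Graph → Set
Connected Γ = ∀ u w → Reach Γ u w

-- genus g = b₁(Γ) = |E| - |V| + 1 (for connected Γ)
genus : Graph → ℤ
genus Γ = (+ m Γ) - (+ n Γ) + 1ℤ

IsTree : Graph → Set
IsTree Γ = Connected Γ × genus Γ ≡ 0ℤ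

-- valence (loops counted twice)
val : (Γ : Graph) → Fin (n Γ) → ℤ
val Γ v = Σℤ (λ e → [ ⌊ proj₁ (ends Γ e) ≟ v ⌋ ] + [ ⌊ proj₂ (ends Γ e) ≟ v ⌋ ])

-- A pseudo-divisor (ℰ , D): ℰ ⊆ E(Γ) as a characteristic function, and
-- D on V(Γ^ℰ) recorded by its values on V(Γ); D(v_e) = 1 for e ∈ ℰ is forced.
record PseudoDivisor (Γ : Graph) : Set where
  constructor pd
  field
    ℰ  : Fin (m Γ) → Bool
    Dv : Fin (n Γ) → ℤ
open PseudoDivisor public

degree : {Γ : Graph} → PseudoDivisor Γ → ℤ
degree {Γ} P = Σℤ (Dv P) + Σℤ (λ e → [ ℰ P e ])

-- A subset V ⊆ V(Γ^ℰ): S on original vertices, T on exceptional ones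
-- (T e = true only allowed for e ∈ ℰ).
record VSubset (Γ : Graph) (P : PseudoDivisor Γ) : Set where
  field
    S    : Fin (n Γ) → Bool
    T    : Fin (m Γ) → Bool
    T⊆ℰ  : ∀ e → T e ≡ true → ℰ P e ≡ true
open VSubset public

Nonempty : {Γ : Graph} {P : PseudoDivisor Γ} → VSubset Γ P → Set
Nonempty W = (∃ λ v → S W v ≡ true) ⊎ (∃ λ e → T W e ≡ true)

D[_] : {Γ : Graph} {P : PseudoDivisor Γ} → VSubset Γ P → ℤ
D[_] {Γ} {P} W = Σℤ (λ v → [ S W v ] * Dv P v) + Σℤ (λ e → [ T W e ])

-- 2·μ(V), with μ(v) = -1 + val(v)/2 on V(Γ) and 0 on exceptional vertices
twoμ : {Γ : Graph} {P : PseudoDivisor Γ} → VSubset Γ P → ℤ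
twoμ {Γ} W = Σℤ (λ v → [ S W v ] * ((val Γ v) - (+ 2)))

-- δ_V: edges of Γ^ℰ between V and its complement
δ : {Γ : Graph} {P : PseudoDivisor Γ} → VSubset Γ P → ℤ
δ {Γ} {P} W = Σℤ edgeContrib
  where
    edgeContrib : Fin (m Γ) → ℤ
    edgeContrib e with ℰ P e
    ... | false = [ S W (proj₁ (ends Γ e)) xor S W (proj₂ (ends Γ e)) ]
    ... | true  = [ S W (proj₁ (ends Γ e)) xor T W e ]
                + [ T W e xor S W (proj₂ (ends Γ e)) ]

-- 2·(D(V) - μ(V) + δ_V/2)  (multiplied by 2 to stay in ℤ)
twiceQ : {Γ : Graph} {P : PseudoDivisor Γ} → VSubset Γ P → ℤ
twiceQ W = (+ 2) * D[ W ] - twoμ W + δ W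

QuasiStable : (Γ : Graph) → Fin (n Γ) → PseudoDivisor Γ → Set
QuasiStable Γ v₀ P =
  degree P ≡ genus Γ - 1ℤ ×
  (∀ (W : VSubset Γ P) → Nonempty W →
     (S W v₀ ≡ true → 0ℤ ≤ twiceQ W) ×
     (S W v₀ ≡ false → 0ℤ < twiceQ W))

D₀ : (Γ : Graph) → Fin (n Γ) → Fin (n Γ) → ℤ
D₀ Γ v₀ v = if ⌊ v ≟ v₀ ⌋ then Data.Integer.-[1+ 0 ] else 0ℤ

Fin' : Graph → Set
Fin' Γ = Fin (n Γ)

-- In a connected graph a nonempty vertex set S can be grown to all of V one vertex at a time,
-- each time along an edge leaving S, which then lies inside S; hence |V| - |S| ≤ |E| - |E(S)|,
-- and for a tree (|E| = |V| - 1) S spans fewer edges than it has vertices. For ℰ = ∅ and D = D₀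
-- the doubled quasistability quantity of S is 2(|S| - |E(S)| - [v₀ ∈ S]), since the valences
-- count edges inside S twice and cut edges once, while δ_S counts cut edges once; so (∅, D₀) is
-- v₀-quasistable. Conversely, quasistability on single vertices gives D(v) ≥ -[v = v₀], and the
-- degree condition D(V) + |ℰ| = g - 1 = -1 leaves no room: equality everywhere and ℰ = ∅.

module Submission where

open import Defs
open import Data.Bool using (Bool; true; false; not; _∧_; _∨_; _xor_)
open import Data.Bool.Properties using (∨-zeroʳ) renaming (_≟_ to _≟ᴮ_)
open import Data.Nat using (zero; suc; z≤n; s≤s)
open import Data.Fin using (Fin; zero; suc; _≟_)
open import Data.Fin.Properties using (any?; suc-injective)
open import Data.Integer
  using (ℤ; +_; -[1+_]; -_; _+_; _-_; _*_; _≤_; _<_; 0ℤ; 1ℤ; +≤+; +<+; nonNegative)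
  renaming (suc to sucℤ)
import Data.Integer.Properties as ℤ
open import Data.Integer.Tactic.RingSolver using (solve-∀)
open import Algebra.Properties.Semiring.Sum ℤ.+-*-semiring
  using (sum; sum-cong-≗; sum-replicate-zero; ∑-distrib-+; ∑-comm; *-distribˡ-sum)
open import Data.Product using (_×_; _,_; proj₁; proj₂; ∃₂)
open import Data.Sum using (inj₁; inj₂)
open import Function using (_∘_)
open import Relation.Nullary using (yes; no; contradiction)
open import Relation.Nullary.Decidable using (⌊_⌋; isYes≗does; dec-true; dec-false)
open import Relation.Binary.PropositionalEquality
  using (_≡_; _≢_; refl; sym; trans; cong; cong₂; subst; module ≡-Reasoning)

nonneg-+≡0 : ∀ {x y} → 0ℤ ≤ x → 0ℤ ≤ y → x + y ≡ 0ℤ → x ≡ 0ℤ × y ≡ 0ℤ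
nonneg-+≡0 {x} {y} 0≤x 0≤y x+y≡0 =
  ℤ.≤-antisym (subst (x ≤_) x+y≡0 (ℤ.i≤i+j x y ⦃ nonNegative 0≤y ⦄)) 0≤x ,
  ℤ.≤-antisym (subst (y ≤_) x+y≡0 (ℤ.i≤j+i y x ⦃ nonNegative 0≤x ⦄)) 0≤y

0<i+1⇒0≤i : ∀ {i} → 0ℤ < i + 1ℤ → 0ℤ ≤ i
0<i+1⇒0≤i {+ _}            _         = +≤+ z≤n
0<i+1⇒0≤i { -[1+ zero ]}   (+<+ ())
0<i+1⇒0≤i { -[1+ suc _ ]}  ()

x+y≡0⇒x≡-y : ∀ {x y} → x + y ≡ 0ℤ → x ≡ - y
x+y≡0⇒x≡-y {x} {y} x+y≡0 = begin
  x          ≡⟨ add-sub x y ⟩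
  x + y - y  ≡⟨ cong (_- y) x+y≡0 ⟩
  0ℤ - y     ≡⟨ ℤ.+-identityˡ (- y) ⟩
  - y        ∎
  where
  open ≡-Reasoning
  add-sub : ∀ x y → x ≡ x + y - y
  add-sub = solve-∀

[]-nonneg : ∀ b → 0ℤ ≤ [ b ]
[]-nonneg true  = +≤+ z≤n
[]-nonneg false = +≤+ z≤n

[]≡0⇒false : ∀ {b} → [ b ] ≡ 0ℤ → b ≡ false
[]≡0⇒false {false} _ = refl

[not]+[]≡1 : ∀ b → [ not b ] + [ b ] ≡ 1ℤ
[not]+[]≡1 true  = refl
[not]+[]≡1 false = refl

[]+[]≡2[∧]+[xor] : ∀ x y → [ x ] + [ y ] ≡ (+ 2) * [ x ∧ y ] + [ x xor y ]
[]+[]≡2[∧]+[xor] true  true  = refl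
[]+[]≡2[∧]+[xor] true  false = refl
[]+[]≡2[∧]+[xor] false true  = refl
[]+[]≡2[∧]+[xor] false false = refl

[xor]≤[]+[] : ∀ x y → [ x xor y ] ≤ [ x ] + [ y ]
[xor]≤[]+[] true  true  = +≤+ z≤n
[xor]≤[]+[] true  false = ℤ.≤-refl
[xor]≤[]+[] false true  = ℤ.≤-refl
[xor]≤[]+[] false false = ℤ.≤-refl

[not]-antitone : ∀ {x y} → (x ≡ true → y ≡ true) → [ not y ] ≤ [ not x ]
[not]-antitone {false} {true}  _   = +≤+ z≤n
[not]-antitone {false} {false} _   = ℤ.≤-refl
[not]-antitone {true}          x⇒y with x⇒y refl
... | refl = ℤ.≤-refl

∧-mono : ∀ {x y x′ y′} → (x ≡ true → x′ ≡ true) → (y ≡ true → y′ ≡ true) →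
         x ∧ y ≡ true → x′ ∧ y′ ≡ true
∧-mono {true} {true} x⇒x′ y⇒y′ _ = cong₂ _∧_ (x⇒x′ refl) (y⇒y′ refl)

Σℤ≡sum : ∀ {k} (f : Fin k → ℤ) → Σℤ f ≡ sum f
Σℤ≡sum {zero}  f = refl
Σℤ≡sum {suc k} f = cong (λ s → f zero + s) (Σℤ≡sum (f ∘ suc))

Σℤ-cong : ∀ {k} {f g : Fin k → ℤ} → (∀ i → f i ≡ g i) → Σℤ f ≡ Σℤ g
Σℤ-cong {f = f} {g} f≗g = trans (Σℤ≡sum f) (trans (sum-cong-≗ f≗g) (sym (Σℤ≡sum g)))

Σℤ-zero : ∀ k → Σℤ {k} (λ _ → 0ℤ) ≡ 0ℤ
Σℤ-zero k = trans (Σℤ≡sum {k} (λ _ → 0ℤ)) (sum-replicate-zero k)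

Σℤ-one : ∀ k → Σℤ {k} (λ _ → 1ℤ) ≡ + k
Σℤ-one zero    = refl
Σℤ-one (suc k) = cong (λ s → 1ℤ + s) (Σℤ-one k)

Σℤ-distrib-+ : ∀ {k} (f g : Fin k → ℤ) → Σℤ (λ i → f i + g i) ≡ Σℤ f + Σℤ g
Σℤ-distrib-+ f g = begin
  Σℤ (λ i → f i + g i)  ≡⟨ Σℤ≡sum (λ i → f i + g i) ⟩
  sum (λ i → f i + g i) ≡⟨ ∑-distrib-+ f g ⟩
  sum f + sum g         ≡⟨ cong₂ _+_ (Σℤ≡sum f) (Σℤ≡sum g) ⟨
  Σℤ f + Σℤ g           ∎
  where open ≡-Reasoning

*-distribˡ-Σℤ : ∀ {k} c (f : Fin k → ℤ) → c * Σℤ f ≡ Σℤ (λ i → c * f i)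
*-distribˡ-Σℤ c f = begin
  c * Σℤ f              ≡⟨ cong (c *_) (Σℤ≡sum f) ⟩
  c * sum f             ≡⟨ *-distribˡ-sum c f ⟩
  sum (λ i → c * f i)   ≡⟨ Σℤ≡sum (λ i → c * f i) ⟨
  Σℤ (λ i → c * f i)    ∎
  where open ≡-Reasoning

Σℤ-comm : ∀ {k l} (h : Fin k → Fin l → ℤ) →
          Σℤ (λ i → Σℤ (h i)) ≡ Σℤ (λ j → Σℤ (λ i → h i j))
Σℤ-comm h = begin
  Σℤ (λ i → Σℤ (h i))             ≡⟨ Σℤ-cong (λ i → Σℤ≡sum (h i)) ⟩
  Σℤ (λ i → sum (h i))            ≡⟨ Σℤ≡sum (λ i → sum (h i)) ⟩
  sum (λ i → sum (h i))           ≡⟨ ∑-comm h ⟩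
  sum (λ j → sum (λ i → h i j))   ≡⟨ Σℤ≡sum (λ j → sum (λ i → h i j)) ⟨
  Σℤ (λ j → sum (λ i → h i j))    ≡⟨ Σℤ-cong (λ j → Σℤ≡sum (λ i → h i j)) ⟨
  Σℤ (λ j → Σℤ (λ i → h i j))     ∎
  where open ≡-Reasoning

⌊≟⌋-refl : ∀ {k} (v : Fin k) → ⌊ v ≟ v ⌋ ≡ true
⌊≟⌋-refl v = trans (isYes≗does (v ≟ v)) (dec-true (v ≟ v) refl)

⌊≟⌋-≢ : ∀ {k} {v w : Fin k} → v ≢ w → ⌊ v ≟ w ⌋ ≡ false
⌊≟⌋-≢ {v = v} {w} v≢w = trans (isYes≗does (v ≟ w)) (dec-false (v ≟ w) v≢w)

⌊≟⌋-sym : ∀ {k} (v w : Fin k) → ⌊ v ≟ w ⌋ ≡ ⌊ w ≟ v ⌋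
⌊≟⌋-sym v w with v ≟ w
... | yes refl = sym (⌊≟⌋-refl v)
... | no v≢w   = sym (⌊≟⌋-≢ (v≢w ∘ sym))

Σℤ-single : ∀ {k} {f : Fin k → ℤ} w → (∀ v → v ≢ w → f v ≡ 0ℤ) → Σℤ f ≡ f w
Σℤ-single {suc k} {f} zero rest≡0 = begin
  f zero + Σℤ (f ∘ suc)       ≡⟨ cong (λ s → f zero + s) (Σℤ-cong (λ v → rest≡0 (suc v) λ ())) ⟩
  f zero + Σℤ {k} (λ _ → 0ℤ)  ≡⟨ cong (λ s → f zero + s) (Σℤ-zero k) ⟩
  f zero + 0ℤ                 ≡⟨ ℤ.+-identityʳ (f zero) ⟩
  f zero                      ∎
  where open ≡-Reasoning
Σℤ-single {suc k} {f} (suc w) rest≡0 = begin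
  f zero + Σℤ (f ∘ suc) ≡⟨ cong (_+ Σℤ (f ∘ suc)) (rest≡0 zero λ ()) ⟩
  0ℤ + Σℤ (f ∘ suc)     ≡⟨ ℤ.+-identityˡ (Σℤ (f ∘ suc)) ⟩
  Σℤ (f ∘ suc)          ≡⟨ Σℤ-single w (λ v v≢w → rest≡0 (suc v) (v≢w ∘ suc-injective)) ⟩
  f (suc w)             ∎
  where open ≡-Reasoning

Σℤ-pointʳ : ∀ {k} (w : Fin k) (f : Fin k → ℤ) → Σℤ (λ v → [ ⌊ v ≟ w ⌋ ] * f v) ≡ f w
Σℤ-pointʳ w f = begin
  Σℤ (λ v → [ ⌊ v ≟ w ⌋ ] * f v) ≡⟨ Σℤ-single w off-diagonal ⟩
  [ ⌊ w ≟ w ⌋ ] * f w            ≡⟨ cong (λ b → [ b ] * f w) (⌊≟⌋-refl w) ⟩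
  1ℤ * f w                       ≡⟨ ℤ.*-identityˡ (f w) ⟩
  f w                            ∎
  where
  open ≡-Reasoning
  off-diagonal : ∀ v → v ≢ w → [ ⌊ v ≟ w ⌋ ] * f v ≡ 0ℤ
  off-diagonal v v≢w = trans (cong (λ b → [ b ] * f v) (⌊≟⌋-≢ v≢w)) (ℤ.*-zeroˡ (f v))

Σℤ-pointˡ : ∀ {k} (w : Fin k) (f : Fin k → ℤ) → Σℤ (λ v → [ ⌊ w ≟ v ⌋ ] * f v) ≡ f w
Σℤ-pointˡ w f = trans (Σℤ-cong (λ v → cong (λ b → [ b ] * f v) (⌊≟⌋-sym w v))) (Σℤ-pointʳ w f)

Σℤ-indicator : ∀ {k} (w : Fin k) → Σℤ (λ v → [ ⌊ v ≟ w ⌋ ]) ≡ 1ℤ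
Σℤ-indicator w = trans (Σℤ-cong (λ v → sym (ℤ.*-identityʳ [ ⌊ v ≟ w ⌋ ]))) (Σℤ-pointʳ w (λ _ → 1ℤ))

Σℤ-mono-≤ : ∀ {k} {f g : Fin k → ℤ} → (∀ i → f i ≤ g i) → Σℤ f ≤ Σℤ g
Σℤ-mono-≤ {zero}  _   = ℤ.≤-refl
Σℤ-mono-≤ {suc k} f≤g = ℤ.+-mono-≤ (f≤g zero) (Σℤ-mono-≤ (f≤g ∘ suc))

Σℤ-mono-< : ∀ {k} {f g : Fin k → ℤ} → (∀ i → f i ≤ g i) → ∀ j → f j < g j → Σℤ f < Σℤ g
Σℤ-mono-< f≤g zero    f<g = ℤ.+-mono-<-≤ f<g (Σℤ-mono-≤ (f≤g ∘ suc))
Σℤ-mono-< f≤g (suc j) f<g = ℤ.+-mono-≤-< (f≤g zero) (Σℤ-mono-< (f≤g ∘ suc) j f<g)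

Σℤ-nonneg : ∀ {k} {f : Fin k → ℤ} → (∀ i → 0ℤ ≤ f i) → 0ℤ ≤ Σℤ f
Σℤ-nonneg {k} {f} 0≤f = subst (_≤ Σℤ f) (Σℤ-zero k) (Σℤ-mono-≤ 0≤f)

Σℤ-nonneg-≡0 : ∀ {k} {f : Fin k → ℤ} → (∀ i → 0ℤ ≤ f i) → Σℤ f ≡ 0ℤ → ∀ i → f i ≡ 0ℤ
Σℤ-nonneg-≡0 0≤f Σ≡0 zero    = proj₁ (nonneg-+≡0 (0≤f zero) (Σℤ-nonneg (0≤f ∘ suc)) Σ≡0)
Σℤ-nonneg-≡0 0≤f Σ≡0 (suc i) =
  Σℤ-nonneg-≡0 (0≤f ∘ suc) (proj₂ (nonneg-+≡0 (0≤f zero) (Σℤ-nonneg (0≤f ∘ suc)) Σ≡0)) i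

module _ (Γ : Graph) where

  src tgt : Fin (m Γ) → Fin' Γ
  src e = proj₁ (ends Γ e)
  tgt e = proj₂ (ends Γ e)

  VertexSet : Set
  VertexSet = Fin' Γ → Bool

  size : VertexSet → ℤ
  size S = Σℤ (λ v → [ S v ])

  spans : VertexSet → Fin (m Γ) → Bool
  spans S e = S (src e) ∧ S (tgt e)

  innerEdges outerEdges cutEdges : VertexSet → ℤ
  innerEdges S = Σℤ (λ e → [ spans S e ])
  outerEdges S = Σℤ (λ e → [ not (spans S e) ])
  cutEdges   S = Σℤ (λ e → [ S (src e) xor S (tgt e) ])

  insert : Fin' Γ → VertexSet → VertexSet
  insert y S v = S v ∨ ⌊ v ≟ y ⌋

  size-nonneg : ∀ S → 0ℤ ≤ size S
  size-nonneg S = Σℤ-nonneg (λ v → []-nonneg (S v))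

  outerEdges+innerEdges : ∀ S → outerEdges S + innerEdges S ≡ + m Γ
  outerEdges+innerEdges S = begin
    outerEdges S + innerEdges S
      ≡⟨ Σℤ-distrib-+ (λ e → [ not (spans S e) ]) (λ e → [ spans S e ]) ⟨
    Σℤ (λ e → [ not (spans S e) ] + [ spans S e ])
      ≡⟨ Σℤ-cong (λ e → [not]+[]≡1 (spans S e)) ⟩
    Σℤ {m Γ} (λ _ → 1ℤ)
      ≡⟨ Σℤ-one (m Γ) ⟩
    + m Γ
      ∎
    where open ≡-Reasoning

  handshake : ∀ (S : VertexSet) →
              Σℤ (λ v → [ S v ] * val Γ v) ≡ Σℤ (λ e → [ S (src e) ] + [ S (tgt e) ])
  handshake S = begin
    Σℤ (λ v → [ S v ] * val Γ v)
      ≡⟨ Σℤ-cong (λ v → *-distribˡ-Σℤ [ S v ] (incidence v)) ⟩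
    Σℤ (λ v → Σℤ (λ e → [ S v ] * incidence v e))
      ≡⟨ Σℤ-comm (λ v e → [ S v ] * incidence v e) ⟩
    Σℤ (λ e → Σℤ (λ v → [ S v ] * incidence v e))
      ≡⟨ Σℤ-cong endpoints ⟩
    Σℤ (λ e → [ S (src e) ] + [ S (tgt e) ])
      ∎
    where
    open ≡-Reasoning
    incidence : Fin' Γ → Fin (m Γ) → ℤ
    incidence v e = [ ⌊ src e ≟ v ⌋ ] + [ ⌊ tgt e ≟ v ⌋ ]

    distrib : ∀ s a b → s * (a + b) ≡ a * s + b * s
    distrib = solve-∀

    endpoints : ∀ e → Σℤ (λ v → [ S v ] * incidence v e) ≡ [ S (src e) ] + [ S (tgt e) ]
    endpoints e = begin
      Σℤ (λ v → [ S v ] * incidence v e)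
        ≡⟨ Σℤ-cong (λ v → distrib [ S v ] [ ⌊ src e ≟ v ⌋ ] [ ⌊ tgt e ≟ v ⌋ ]) ⟩
      Σℤ (λ v → [ ⌊ src e ≟ v ⌋ ] * [ S v ] + [ ⌊ tgt e ≟ v ⌋ ] * [ S v ])
        ≡⟨ Σℤ-distrib-+ (λ v → [ ⌊ src e ≟ v ⌋ ] * [ S v ]) (λ v → [ ⌊ tgt e ≟ v ⌋ ] * [ S v ]) ⟩
      Σℤ (λ v → [ ⌊ src e ≟ v ⌋ ] * [ S v ]) + Σℤ (λ v → [ ⌊ tgt e ≟ v ⌋ ] * [ S v ])
        ≡⟨ cong₂ _+_ (Σℤ-pointˡ (src e) (λ v → [ S v ])) (Σℤ-pointˡ (tgt e) (λ v → [ S v ])) ⟩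
      [ S (src e) ] + [ S (tgt e) ]
        ∎
      where open ≡-Reasoning

  endpoints≡inner+cut : ∀ (S : VertexSet) →
    Σℤ (λ e → [ S (src e) ] + [ S (tgt e) ]) ≡ (+ 2) * innerEdges S + cutEdges S
  endpoints≡inner+cut S = begin
    Σℤ (λ e → [ S (src e) ] + [ S (tgt e) ])
      ≡⟨ Σℤ-cong (λ e → []+[]≡2[∧]+[xor] (S (src e)) (S (tgt e))) ⟩
    Σℤ (λ e → (+ 2) * [ spans S e ] + [ S (src e) xor S (tgt e) ])
      ≡⟨ Σℤ-distrib-+ (λ e → (+ 2) * [ spans S e ]) (λ e → [ S (src e) xor S (tgt e) ]) ⟩
    Σℤ (λ e → (+ 2) * [ spans S e ]) + cutEdges S
      ≡⟨ cong (_+ cutEdges S) (*-distribˡ-Σℤ (+ 2) (λ e → [ spans S e ])) ⟨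
    (+ 2) * innerEdges S + cutEdges S
      ∎
    where open ≡-Reasoning

  insert-⊇ : ∀ S y {v} → S v ≡ true → insert y S v ≡ true
  insert-⊇ S y {v} v∈S = cong (_∨ ⌊ v ≟ y ⌋) v∈S

  insert-∋ : ∀ S y → insert y S y ≡ true
  insert-∋ S y = trans (cong (S y ∨_) (⌊≟⌋-refl y)) (∨-zeroʳ (S y))

  size-insert : ∀ {S y} → S y ≡ false → size (insert y S) ≡ size S + 1ℤ
  size-insert {S} {y} y∉S = begin
    Σℤ (λ v → [ S v ∨ ⌊ v ≟ y ⌋ ])          ≡⟨ Σℤ-cong disjoint ⟩
    Σℤ (λ v → [ S v ] + [ ⌊ v ≟ y ⌋ ])      ≡⟨ Σℤ-distrib-+ (λ v → [ S v ]) (λ v → [ ⌊ v ≟ y ⌋ ]) ⟩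
    size S + Σℤ (λ v → [ ⌊ v ≟ y ⌋ ])       ≡⟨ cong (λ t → size S + t) (Σℤ-indicator y) ⟩
    size S + 1ℤ                             ∎
    where
    open ≡-Reasoning
    disjoint : ∀ v → [ S v ∨ ⌊ v ≟ y ⌋ ] ≡ [ S v ] + [ ⌊ v ≟ y ⌋ ]
    disjoint v with v ≟ y
    ... | yes refl rewrite y∉S = refl
    ... | no _ with S v
    ...   | true  = refl
    ...   | false = refl

  outerEdges-insert : ∀ S y e → spans S e ≡ false → spans (insert y S) e ≡ true →
                      outerEdges (insert y S) < outerEdges S
  outerEdges-insert S y e e∉S e∈S′ = Σℤ-mono-< antitone e joined
    where
    antitone : ∀ e′ → [ not (spans (insert y S) e′) ] ≤ [ not (spans S e′) ]
    antitone e′ = [not]-antitone (∧-mono (insert-⊇ S y) (insert-⊇ S y))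

    joined : [ not (spans (insert y S) e) ] < [ not (spans S e) ]
    joined rewrite e∉S | e∈S′ = +<+ (s≤s z≤n)

  leaving-edge : ∀ (S : VertexSet) {u w} → Reach Γ u w → S u ≡ true → S w ≡ false →
                 ∃₂ λ e y → S y ≡ false × spans S e ≡ false × spans (insert y S) e ≡ true
  leaving-edge S here u∈S w∉S = contradiction (trans (sym u∈S) w∉S) λ ()
  leaving-edge S (stepF e refl r) src∈S w∉S with S (tgt e) in tgt∈?
  ... | true  = leaving-edge S r tgt∈? w∉S
  ... | false = e , tgt e , tgt∈? , cong₂ _∧_ src∈S tgt∈? ,
                cong₂ _∧_ (insert-⊇ S (tgt e) src∈S) (insert-∋ S (tgt e))
  leaving-edge S (stepB e refl r) tgt∈S w∉S with S (src e) in src∈?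
  ... | true  = leaving-edge S r src∈? w∉S
  ... | false = e , src e , src∈? , cong₂ _∧_ src∈? tgt∈S ,
                cong₂ _∧_ (insert-∋ S (src e)) (insert-⊇ S (src e) tgt∈S)

  spanning : Connected Γ → ∀ (S : VertexSet) {s} → S s ≡ true → + n Γ ≤ size S + outerEdges S
  spanning conn S {s} s∈S =
    grow (n Γ) S s∈S (ℤ.i≤j+i (+ n Γ) (size S) ⦃ nonNegative (size-nonneg S) ⦄)
    where
    outerEdges-nonneg : ∀ S → 0ℤ ≤ outerEdges S
    outerEdges-nonneg S = Σℤ-nonneg (λ e → []-nonneg (not (spans S e)))

    grow : ∀ k (S : VertexSet) → S s ≡ true → + n Γ ≤ size S + + k → + n Γ ≤ size S + outerEdges S
    grow zero    S _   n≤S+k = ℤ.≤-trans n≤S+k (ℤ.+-monoʳ-≤ (size S) (outerEdges-nonneg S))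
    grow (suc k) S s∈S n≤S+k with any? (λ v → S v ≟ᴮ false)
    ... | no  ∄v∉S = begin
      + n Γ                  ≡⟨ Σℤ-one (n Γ) ⟨
      Σℤ {n Γ} (λ _ → 1ℤ)    ≡⟨ Σℤ-cong (λ v → cong [_] (everywhere v)) ⟨
      size S                 ≤⟨ ℤ.i≤i+j (size S) _ ⦃ nonNegative (outerEdges-nonneg S) ⦄ ⟩
      size S + outerEdges S  ∎
      where
      open ℤ.≤-Reasoning
      everywhere : ∀ v → S v ≡ true
      everywhere v with S v in v∈S?
      ... | true  = refl
      ... | false = contradiction (v , v∈S?) ∄v∉S
    ... | yes (w , w∉S) with leaving-edge S (conn s w) s∈S w∉S
    ...   | e , y , y∉S , e∉S , e∈S′ = begin
      + n Γ                          ≤⟨ grow k S′ (insert-⊇ S y s∈S) n≤S′+k ⟩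
      size S′ + outerEdges S′        ≡⟨ cong (_+ outerEdges S′) (size-insert y∉S) ⟩
      size S + 1ℤ + outerEdges S′    ≡⟨ ℤ.+-assoc (size S) 1ℤ (outerEdges S′) ⟩
      size S + sucℤ (outerEdges S′)  ≤⟨ ℤ.+-monoʳ-≤ (size S) (ℤ.i<j⇒suc[i]≤j S′-has-fewer) ⟩
      size S + outerEdges S          ∎
      where
      open ℤ.≤-Reasoning
      S′ : VertexSet
      S′ = insert y S
      n≤S′+k : + n Γ ≤ size S′ + + k
      n≤S′+k = subst (+ n Γ ≤_) (trans (sym (ℤ.+-assoc (size S) 1ℤ (+ k)))
                                       (cong (_+ + k) (sym (size-insert y∉S)))) n≤S+k
      S′-has-fewer : outerEdges S′ < outerEdges S
      S′-has-fewer = outerEdges-insert S y e e∉S e∈S′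

  innerEdges<size : IsTree Γ → ∀ (S : VertexSet) {s} → S s ≡ true → innerEdges S < size S
  innerEdges<size (conn , genus≡0) S s∈S = ℤ.suc[i]≤j⇒i<j (begin
    1ℤ + I                                 ≡⟨ decompose N O I M ⟩
    N - O + (O + I - M) + (M - N + 1ℤ)     ≡⟨ cong₂ (λ a g → N - O + (a - M) + g)
                                                    (outerEdges+innerEdges S) genus≡0 ⟩
    N - O + (M - M) + 0ℤ                   ≡⟨ simplify N O M ⟩
    N - O                                  ≤⟨ ℤ.+-monoˡ-≤ (- O) (spanning conn S s∈S) ⟩
    size S + O - O                         ≡⟨ cancel (size S) O ⟩
    size S                                 ∎)
    where
    open ℤ.≤-Reasoning
    N O I M : ℤ
    N = + n Γ
    O = outerEdges S
    I = innerEdges S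
    M = + m Γ
    decompose : ∀ N O I M → 1ℤ + I ≡ N - O + (O + I - M) + (M - N + 1ℤ)
    decompose = solve-∀
    simplify : ∀ N O M → N - O + (M - M) + 0ℤ ≡ N - O
    simplify = solve-∀
    cancel : ∀ x O → x + O - O ≡ x
    cancel = solve-∀

cutContribution : (e∈ℰ src∈V vₑ∈V tgt∈V : Bool) → ℤ
cutContribution false x _ y = [ x xor y ]
cutContribution true  x t y = [ x xor t ] + [ t xor y ]

cutContribution-≤ : ∀ b x y → cutContribution b x false y ≤ [ x ] + [ y ]
cutContribution-≤ false x     y = [xor]≤[]+[] x y
cutContribution-≤ true  true  y = ℤ.≤-refl
cutContribution-≤ true  false y = ℤ.≤-refl

module _ {Γ : Graph} {P : PseudoDivisor Γ} where

  δ≡Σ-cutContribution : ∀ (W : VSubset Γ P) →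
    δ W ≡ Σℤ (λ e → cutContribution (ℰ P e) (S W (src Γ e)) (T W e) (S W (tgt Γ e)))
  δ≡Σ-cutContribution W = termwise
    where
    -- The summand of δ is local to its definition, so it is named by unification:
    -- the use in termwise fixes the underscore before the clauses of summand are checked.
    summand : ∀ e → _ ≡ cutContribution (ℰ P e) (S W (src Γ e)) (T W e) (S W (tgt Γ e))
    termwise : δ W ≡ Σℤ (λ e → cutContribution (ℰ P e) (S W (src Γ e)) (T W e) (S W (tgt Γ e)))
    termwise = Σℤ-cong summand
    summand e with ℰ P e
    ... | false = refl
    ... | true  = refl

  δ≤Σ[]*val : ∀ (W : VSubset Γ P) → (∀ e → T W e ≡ false) → δ W ≤ Σℤ (λ v → [ S W v ] * val Γ v)
  δ≤Σ[]*val W no-exceptional = begin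
    δ W                                                  ≡⟨ δ≡Σ-cutContribution W ⟩
    Σℤ (λ e → cutContribution (ℰ P e) (S W (src Γ e)) (T W e) (S W (tgt Γ e)))
                                                         ≤⟨ Σℤ-mono-≤ bound ⟩
    Σℤ (λ e → [ S W (src Γ e) ] + [ S W (tgt Γ e) ])     ≡⟨ handshake Γ (S W) ⟨
    Σℤ (λ v → [ S W v ] * val Γ v)                       ∎
    where
    open ℤ.≤-Reasoning
    bound : ∀ e → cutContribution (ℰ P e) (S W (src Γ e)) (T W e) (S W (tgt Γ e)) ≤
                  [ S W (src Γ e) ] + [ S W (tgt Γ e) ]
    bound e rewrite no-exceptional e = cutContribution-≤ (ℰ P e) (S W (src Γ e)) (S W (tgt Γ e))

  twoμ≡ : ∀ (W : VSubset Γ P) →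
    twoμ W ≡ (+ 2) * innerEdges Γ (S W) + cutEdges Γ (S W) - (+ 2) * size Γ (S W)
  twoμ≡ W = begin
    Σℤ (λ v → [ S W v ] * (val Γ v - + 2))
      ≡⟨ Σℤ-cong (λ v → expand [ S W v ] (val Γ v)) ⟩
    Σℤ (λ v → [ S W v ] * val Γ v + -[1+ 1 ] * [ S W v ])
      ≡⟨ Σℤ-distrib-+ (λ v → [ S W v ] * val Γ v) (λ v → -[1+ 1 ] * [ S W v ]) ⟩
    Σℤ (λ v → [ S W v ] * val Γ v) + Σℤ (λ v → -[1+ 1 ] * [ S W v ])
      ≡⟨ cong₂ _+_ (trans (handshake Γ (S W)) (endpoints≡inner+cut Γ (S W)))
                   (sym (*-distribˡ-Σℤ -[1+ 1 ] (λ v → [ S W v ]))) ⟩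
    (+ 2) * innerEdges Γ (S W) + cutEdges Γ (S W) + -[1+ 1 ] * size Γ (S W)
      ≡⟨ regroup ((+ 2) * innerEdges Γ (S W) + cutEdges Γ (S W)) (size Γ (S W)) ⟩
    (+ 2) * innerEdges Γ (S W) + cutEdges Γ (S W) - (+ 2) * size Γ (S W)
      ∎
    where
    open ≡-Reasoning
    expand : ∀ s x → s * (x - + 2) ≡ s * x + -[1+ 1 ] * s
    expand = solve-∀
    regroup : ∀ a z → a + -[1+ 1 ] * z ≡ a - (+ 2) * z
    regroup = solve-∀

margin-stable : ∀ {i j} → i < j → ∀ b →
  (b ≡ true → 0ℤ ≤ (+ 2) * (j - i - [ b ])) × (b ≡ false → 0ℤ < (+ 2) * (j - i - [ b ]))
margin-stable {i} {j} i<j b =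
    (λ { refl → ℤ.*-monoˡ-≤-nonNeg (+ 2) (ℤ.i≤j⇒0≤j-i (ℤ.i<j⇒suc[i]≤j 0<j-i)) })
  , (λ { refl → ℤ.*-monoˡ-<-pos (+ 2) (subst (0ℤ <_) (sym (ℤ.+-identityʳ (j - i))) 0<j-i) })
  where
  0<j-i : 0ℤ < j - i
  0<j-i = subst (_< j - i) (ℤ.+-inverseʳ i) (ℤ.+-monoˡ-< (- i) i<j)

module _ (Γ : Graph) (v₀ : Fin' Γ) where

  D₀≡-[≟] : ∀ v → D₀ Γ v₀ v ≡ - [ ⌊ v ≟ v₀ ⌋ ]
  D₀≡-[≟] v with ⌊ v ≟ v₀ ⌋
  ... | true  = refl
  ... | false = refl

  P₀ : PseudoDivisor Γ
  P₀ = pd (λ _ → false) (D₀ Γ v₀)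

  degree-P₀ : genus Γ ≡ 0ℤ → degree P₀ ≡ genus Γ - 1ℤ
  degree-P₀ genus≡0 = begin
    Σℤ (D₀ Γ v₀) + Σℤ {m Γ} (λ _ → 0ℤ)
      ≡⟨ cong₂ _+_ (Σℤ-cong (λ v → trans (D₀≡-[≟] v) (neg [ ⌊ v ≟ v₀ ⌋ ]))) (Σℤ-zero (m Γ)) ⟩
    Σℤ (λ v → [ ⌊ v ≟ v₀ ⌋ ] * -[1+ 0 ]) + 0ℤ
      ≡⟨ cong (_+ 0ℤ) (Σℤ-pointʳ v₀ (λ _ → -[1+ 0 ])) ⟩
    -[1+ 0 ] + 0ℤ
      ≡⟨ cong (_- 1ℤ) genus≡0 ⟨
    genus Γ - 1ℤ
      ∎
    where
    open ≡-Reasoning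
    neg : ∀ x → - x ≡ x * -[1+ 0 ]
    neg = solve-∀

  D[P₀] : ∀ (W : VSubset Γ P₀) → D[ W ] ≡ - [ S W v₀ ]
  D[P₀] W = begin
    Σℤ (λ v → [ S W v ] * D₀ Γ v₀ v) + Σℤ (λ e → [ T W e ])
      ≡⟨ cong₂ _+_ (Σℤ-cong (λ v → cong ([ S W v ] *_) (D₀≡-[≟] v)))
                   (Σℤ-cong (λ e → cong [_] (no-exceptional e))) ⟩
    Σℤ (λ v → [ S W v ] * - [ ⌊ v ≟ v₀ ⌋ ]) + Σℤ {m Γ} (λ _ → 0ℤ)
      ≡⟨ cong₂ _+_ (Σℤ-cong (λ v → swap [ S W v ] [ ⌊ v ≟ v₀ ⌋ ])) (Σℤ-zero (m Γ)) ⟩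
    Σℤ (λ v → [ ⌊ v ≟ v₀ ⌋ ] * - [ S W v ]) + 0ℤ
      ≡⟨ cong (_+ 0ℤ) (Σℤ-pointʳ v₀ (λ v → - [ S W v ])) ⟩
    - [ S W v₀ ] + 0ℤ
      ≡⟨ ℤ.+-identityʳ (- [ S W v₀ ]) ⟩
    - [ S W v₀ ]
      ∎
    where
    open ≡-Reasoning
    swap : ∀ s d → s * - d ≡ d * - s
    swap = solve-∀
    no-exceptional : ∀ e → T W e ≡ false
    no-exceptional e with T W e in e∈T
    ... | true  = contradiction (T⊆ℰ W e e∈T) λ ()
    ... | false = refl

  twiceQ-P₀ : ∀ (W : VSubset Γ P₀) →
    twiceQ W ≡ (+ 2) * (size Γ (S W) - innerEdges Γ (S W) - [ S W v₀ ])
  twiceQ-P₀ W = begin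
    (+ 2) * D[ W ] - twoμ W + δ W
      ≡⟨ cong₂ (λ d μ → (+ 2) * d - μ + cutEdges Γ (S W)) (D[P₀] W) (twoμ≡ W) ⟩
    (+ 2) * - [ S W v₀ ] - ((+ 2) * innerEdges Γ (S W) + cutEdges Γ (S W) - (+ 2) * size Γ (S W))
      + cutEdges Γ (S W)
      ≡⟨ collect [ S W v₀ ] (innerEdges Γ (S W)) (cutEdges Γ (S W)) (size Γ (S W)) ⟩
    (+ 2) * (size Γ (S W) - innerEdges Γ (S W) - [ S W v₀ ])
      ∎
    where
    open ≡-Reasoning
    collect : ∀ s i c z → (+ 2) * - s - ((+ 2) * i + c - (+ 2) * z) + c ≡ (+ 2) * (z - i - s)
    collect = solve-∀

  D₀-quasistable : IsTree Γ → QuasiStable Γ v₀ P₀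
  D₀-quasistable tree = degree-P₀ (proj₂ tree) , stable
    where
    stable : ∀ (W : VSubset Γ P₀) → Nonempty W →
             (S W v₀ ≡ true → 0ℤ ≤ twiceQ W) × (S W v₀ ≡ false → 0ℤ < twiceQ W)
    stable W (inj₂ (e , e∈T)) = contradiction (T⊆ℰ W e e∈T) λ ()
    stable W (inj₁ (s , s∈S)) rewrite twiceQ-P₀ W =
      margin-stable (innerEdges<size Γ tree (S W) s∈S) (S W v₀)

module _ {Γ : Graph} (P : PseudoDivisor Γ) where

  singleton : Fin' Γ → VSubset Γ P
  singleton w = record { S = λ v → ⌊ v ≟ w ⌋ ; T = λ _ → false ; T⊆ℰ = λ _ () }

  twiceQ-singleton-≤ : ∀ w → twiceQ (singleton w) ≤ (+ 2) * (Dv P w + 1ℤ)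
  twiceQ-singleton-≤ w = begin
    (+ 2) * D[ singleton w ] - twoμ (singleton w) + δ (singleton w)
      ≡⟨ cong₂ (λ d μ → (+ 2) * d - μ + δ (singleton w))
               (cong₂ _+_ (Σℤ-pointʳ w (Dv P)) (Σℤ-zero (m Γ)))
               (Σℤ-pointʳ w (λ v → val Γ v - + 2)) ⟩
    (+ 2) * (Dv P w + 0ℤ) - (val Γ w - + 2) + δ (singleton w)
      ≤⟨ ℤ.+-monoʳ-≤ ((+ 2) * (Dv P w + 0ℤ) - (val Γ w - + 2)) δ≤val ⟩
    (+ 2) * (Dv P w + 0ℤ) - (val Γ w - + 2) + val Γ w
      ≡⟨ collect (Dv P w) (val Γ w) ⟩
    (+ 2) * (Dv P w + 1ℤ)
      ∎
    where
    open ℤ.≤-Reasoning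
    δ≤val : δ (singleton w) ≤ val Γ w
    δ≤val = ℤ.≤-trans (δ≤Σ[]*val (singleton w) (λ _ → refl)) (ℤ.≤-reflexive (Σℤ-pointʳ w (val Γ)))
    collect : ∀ d x → (+ 2) * (d + 0ℤ) - (x - + 2) + x ≡ (+ 2) * (d + 1ℤ)
    collect = solve-∀

  module _ (v₀ : Fin' Γ) (quasistable : QuasiStable Γ v₀ P) where

    quasistable-lower-bound : ∀ w → 0ℤ ≤ Dv P w + [ ⌊ w ≟ v₀ ⌋ ]
    quasistable-lower-bound w with w ≟ v₀ | proj₂ quasistable (singleton w) (inj₁ (w , ⌊≟⌋-refl w))
    ... | yes refl | v₀∈W⇒0≤ , _ =
      ℤ.*-cancelˡ-≤-pos 0ℤ (Dv P w + 1ℤ) (+ 2)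
        (ℤ.≤-trans (v₀∈W⇒0≤ (⌊≟⌋-refl w)) (twiceQ-singleton-≤ w))
    ... | no w≢v₀  | _ , v₀∉W⇒0< =
      subst (0ℤ ≤_) (sym (ℤ.+-identityʳ (Dv P w)))
        (0<i+1⇒0≤i (ℤ.*-cancelˡ-<-nonNeg (+ 2)
          (ℤ.<-≤-trans (v₀∉W⇒0< (⌊≟⌋-≢ (w≢v₀ ∘ sym))) (twiceQ-singleton-≤ w))))

    quasistable-unique : genus Γ ≡ 0ℤ → (∀ e → ℰ P e ≡ false) × (∀ v → Dv P v ≡ D₀ Γ v₀ v)
    quasistable-unique genus≡0 =
        (λ e → []≡0⇒false (Σℤ-nonneg-≡0 0≤g (proj₂ split) e))
      , (λ v → trans (x+y≡0⇒x≡-y (Σℤ-nonneg-≡0 quasistable-lower-bound (proj₁ split) v))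
                     (sym (D₀≡-[≟] Γ v₀ v)))
      where
      f : Fin' Γ → ℤ
      f v = Dv P v + [ ⌊ v ≟ v₀ ⌋ ]
      g : Fin (m Γ) → ℤ
      g e = [ ℰ P e ]
      0≤g : ∀ e → 0ℤ ≤ g e
      0≤g e = []-nonneg (ℰ P e)
      Σf+Σg≡0 : Σℤ f + Σℤ g ≡ 0ℤ
      Σf+Σg≡0 = begin
        Σℤ f + Σℤ g                        ≡⟨ cong (_+ Σℤ g) (Σℤ-distrib-+ (Dv P) _) ⟩
        Σℤ (Dv P) + Σℤ (λ v → [ ⌊ v ≟ v₀ ⌋ ]) + Σℤ g
                                           ≡⟨ cong (λ x → Σℤ (Dv P) + x + Σℤ g) (Σℤ-indicator v₀) ⟩
        Σℤ (Dv P) + 1ℤ + Σℤ g              ≡⟨ swap (Σℤ (Dv P)) (Σℤ g) ⟩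
        degree P + 1ℤ                      ≡⟨ cong (_+ 1ℤ) (proj₁ quasistable) ⟩
        genus Γ - 1ℤ + 1ℤ                  ≡⟨ sub-add (genus Γ) ⟩
        genus Γ                            ≡⟨ genus≡0 ⟩
        0ℤ                                 ∎
        where
        open ≡-Reasoning
        swap : ∀ d e → d + 1ℤ + e ≡ d + e + 1ℤ
        swap = solve-∀
        sub-add : ∀ x → x - 1ℤ + 1ℤ ≡ x
        sub-add = solve-∀
      split : Σℤ f ≡ 0ℤ × Σℤ g ≡ 0ℤ
      split = nonneg-+≡0 (Σℤ-nonneg quasistable-lower-bound) (Σℤ-nonneg 0≤g) Σf+Σg≡0

lemma5p14 : (Γ : Graph) → IsTree Γ → (v₀ : Fin' Γ) →
    QuasiStable Γ v₀ (pd (λ _ → false) (D₀ Γ v₀)) ×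
    (∀ P → QuasiStable Γ v₀ P →
      (∀ e → ℰ P e ≡ false) × (∀ v → Dv P v ≡ D₀ Γ v₀ v))
lemma5p14 Γ tree v₀ =
  D₀-quasistable Γ v₀ tree , λ P quasistable → quasistable-unique P v₀ quasistable (proj₂ tree)
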